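{- Let $T$ be a decomposition tree and $v$ an internal node of $T$ labeled $\oplus$, with left child $v_l$ and right child $v_r$. Let $\ddot v$ denote a node labeled $\otimes$ with the same left child $v_l$ and right child $v_r$ (so $\hat G(\ddot v)=\hat G(v)$ and $\hat{TS}(\ddot v)=\hat{TS}(v_l)\cup\hat{TS}(v_r)$). Then $\hat\gamma_k(v)\ge\hat\gamma_k(\ddot v)$ for every $0\le k\le|\hat{TS}(v)|$.
   Context: All graphs are finite, simple and undirected. For a graph $H$ and $S\subseteq V(H)$, $N_H[S]$ is the closed neighbourhood of $S$ in $H$ and $H[S]$ the induced subgraph; a graph with no vertices is regarded as having a (empty) perfect matching. A decomposition tree is a rooted tree $T$ in which every internal node has exactly two children, a left child $v_l$ and a right child $v_r$, and carries one of the labels $\otimes$ (true twin), $\odot$ (false twin), $\oplus$ (attachment). To each node $v$ are associated a graph $\hat G(v)$ and a twin set $\hat{TS}(v)\subseteq V(\hat G(v))$: for a leaf, $\hat G(v)$ is a single vertex $x$ (distinct leaves giving distinct vertices) and $\hat{TS}(v)=\{x\}$; for an internal node $v$, $V(\hat G(v))=V(\hat G(v_l))\cup V(\hat G(v_r))$ and: if $v$ is labeled $\otimes$, $E(\hat G(v))=E(\hat G(v_l))\cup E(\hat G(v_r))\cup\{xy: x\in \hat{TS}(v_l), y\in\hat{TS}(v_r)\}$ and $\hat{TS}(v)=\hat{TS}(v_l)\cup\hat{TS}(v_r)$; if labeled $\odot$, $E(\hat G(v))=E(\hat G(v_l))\cup E(\hat G(v_r))$ and $\hat{TS}(v)=\hat{TS}(v_l)\cup\hat{TS}(v_r)$;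 if labeled $\oplus$, the edge set is as for $\otimes$ and $\hat{TS}(v)=\hat{TS}(v_l)$. For a node $u$ and $0\le k\le|\hat{TS}(u)|$, $\hat\gamma_k(u)$ is the minimum of $|S|$ over all $S\subseteq V(\hat G(u))$ with $V(\hat G(u))\setminus \hat{TS}(u)\subseteq N_{\hat G(u)}[S]$ for which there is $X\subseteq S\cap\hat{TS}(u)$, $|X|=k$, such that $\hat G(u)[S\setminus X]$ has a perfect matching. -}

module Defs where

open import Data.Bool using (Bool; true; false; _∧_; _∨_; not; if_then_else_; T)
open import Data.Nat using (ℕ; zero; suc; _+_; _≤_)
open import Data.Product using (Σ; _×_; _,_; ∃)
open import Data.Sum using (_⊎_)
open import Data.Empty using (⊥)
open import Data.Unit using (⊤)
open import Relation.Binary.PropositionalEquality using (_≡_; _≢_)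

-- Node labels: ⊗ (true twin), ⊙ (false twin), ⊕ (attachment)
data Label : Set where
  ⊗ ⊙ ⊕ : Label

-- A decomposition tree: every internal node has a label, a left and a right child.
-- (Ĝ(v) depends only on the subtree rooted at v, so we work with subtrees.)
data DTree : Set where
  leaf : DTree
  node : Label → DTree → DTree → DTree

-- Vertices of Ĝ(t): the leaves of t (distinct leaves are distinct vertices).
data Vertex : DTree → Set where
  here  : Vertex leaf
  left  : ∀ {a l r} → Vertex l → Vertex (node a l r)
  right : ∀ {a l r} → Vertex r → Vertex (node a l r)

inTS : (t : DTree) → Vertex t → Bool
inTS leaf here = true
inTS (node ⊗ l r) (left x)  = inTS l x
inTS (node ⊗ l r) (right x) = inTS r x
inTS (node ⊙ l r) (left x)  = inTS l x
inTS (node ⊙ l r) (right x) = inTS r x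
inTS (node ⊕ l r) (left x)  = inTS l x
inTS (node ⊕ l r) (right x) = false

cross : Label → Bool → Bool → Bool
cross ⊗ a b = a ∧ b
cross ⊙ a b = false
cross ⊕ a b = a ∧ b

adj : (t : DTree) → Vertex t → Vertex t → Bool
adj leaf here here = false
adj (node a l r) (left x)  (left y)  = adj l x y
adj (node a l r) (right x) (right y) = adj r x y
adj (node a l r) (left x)  (right y) = cross a (inTS l x) (inTS r y)
adj (node a l r) (right x) (left y)  = cross a (inTS l y) (inTS r x)

Adj : (t : DTree) → Vertex t → Vertex t → Set
Adj t x y = T (adj t x y)

VSet : DTree → Set
VSet t = Vertex t → Bool

card : (t : DTree) → VSet t → ℕ
card leaf f = if f here then 1 else 0
card (node a l r) f = card l (λ x → f (left x)) + card r (λ x → f (right x))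

tsSize : DTree → ℕ
tsSize t = card t (inTS t)

DominatesOutsideTS : (t : DTree) → VSet t → Set
DominatesOutsideTS t S =
  ∀ x → T (not (inTS t x)) → Σ (Vertex t) λ y → T (S y) × (y ≡ x ⊎ Adj t y x)

-- Ĝ(t)[W] has a perfect matching: a fixed-point-free involution m on W
-- mapping every vertex of W to a neighbour in W (the empty graph has one).
HasPerfectMatching : (t : DTree) → VSet t → Set
HasPerfectMatching t W =
  Σ (Vertex t → Vertex t) λ m →
    ∀ x → T (W x) → T (W (m x)) × (m x ≢ x) × Adj t x (m x) × (m (m x) ≡ x)

Feasible : (t : DTree) → ℕ → VSet t → Set
Feasible t k S =
  DominatesOutsideTS t S ×
  Σ (VSet t) λ X →
    (∀ x → T (X x) → T (S x ∧ inTS t x)) ×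
    card t X ≡ k ×
    HasPerfectMatching t (λ x → S x ∧ not (X x))

-- γ̂_k(t) = g : g is the minimum of |S| over admissible S
-- (if no S is admissible, γ̂_k(t) = ∞ and no g satisfies this).
IsGammaHat : (t : DTree) → ℕ → ℕ → Set
IsGammaHat t k g =
  (Σ (VSet t) λ S → Feasible t k S × card t S ≡ g) ×
  (∀ S → Feasible t k S → g ≤ card t S)

{-# OPTIONS --safe #-}
-- Ĝ(v) and Ĝ(v̈) are the same graph and TŜ(v) ⊆ TŜ(v̈), so every set admissible for γ̂_k(v)
-- is admissible for γ̂_k(v̈): fewer vertices need to be dominated, and the witness
-- X ⊆ S ∩ TŜ(v) still lies in TŜ(v̈). Hence the minimum over the larger family is no larger.
-- Constructively that minimum must still be shown to exist; admissibility is decidable, since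
-- all quantifiers (over vertices, vertex sets and matchings) range over finite enumerations,
-- so it is found by exhaustive search.
module Submission where

open import Defs
open import Data.Bool using (true; false; _∧_; not; T; if_then_else_)
open import Data.Bool.Properties using (T-∧)
open import Data.Nat using (ℕ; _≤_; _+_) renaming (_≟_ to _≟ℕ_)
open import Data.Nat.Properties using (≤-totalOrder; ≤-trans; ≤-reflexive)
open import Data.Product using (Σ; ∃; _×_; _,_)
open import Data.Sum using (inj₁; inj₂)
open import Data.Unit using (tt)
open import Data.List using (List; []; _∷_; map; _++_; cartesianProductWith; filter)
open import Data.List.Extrema ≤-totalOrder using (argmin; argmin-all; f[argmin]≤f[xs])
open import Data.List.Membership.Propositional using (_∈_; lose)
open import Data.List.Membership.Propositional.Properties
  using (∈-map⁺; ∈-++⁺ˡ; ∈-++⁺ʳ; ∈-cartesianProductWith⁺; ∈-filter⁺)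
open import Data.List.Relation.Unary.All as All using (all?)
open import Data.List.Relation.Unary.All.Properties using (all-filter)
open import Data.List.Relation.Unary.Any using (Any; here; there; any?; satisfied)
open import Function using (_∘_; const; Equivalence)
open import Relation.Binary.Definitions using (DecidableEquality)
open import Relation.Binary.PropositionalEquality
open import Relation.Nullary using (Dec; yes; no; ¬?)
open import Relation.Nullary.Decidable using (map′; T?; _×-dec_; _⊎-dec_; _→-dec_)
open import Relation.Unary using (Decidable)

left-injective : ∀ {a l r} {x y : Vertex l} → left {a} {l} {r} x ≡ left y → x ≡ y
left-injective refl = refl

right-injective : ∀ {a l r} {x y : Vertex r} → right {a} {l} {r} x ≡ right y → x ≡ y
right-injective refl = refl

_≟_ : ∀ {t} → DecidableEquality (Vertex t)
here    ≟ here    = yes refl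
left x  ≟ left y  = map′ (cong left) left-injective (x ≟ y)
left _  ≟ right _ = no λ ()
right _ ≟ left _  = no λ ()
right x ≟ right y = map′ (cong right) right-injective (x ≟ y)

vertices : (t : DTree) → List (Vertex t)
vertices leaf         = here ∷ []
vertices (node _ l r) = map left (vertices l) ++ map right (vertices r)

∈-vertices : ∀ {t} (x : Vertex t) → x ∈ vertices t
∈-vertices here                  = here refl
∈-vertices (left x)              = ∈-++⁺ˡ (∈-map⁺ left (∈-vertices x))
∈-vertices {node _ l _} (right x) = ∈-++⁺ʳ (map left (vertices l)) (∈-map⁺ right (∈-vertices x))

all-vertices? : ∀ {t} {P : Vertex t → Set} → Decidable P → Dec (∀ x → P x)
all-vertices? {t} P? =
  map′ (λ ps x → All.lookup ps (∈-vertices x)) (λ ps → All.tabulate λ {x} _ → ps x)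
       (all? P? (vertices t))

any-vertex? : ∀ {t} {P : Vertex t → Set} → Decidable P → Dec (∃ P)
any-vertex? {t} P? =
  map′ satisfied (λ (x , px) → lose (∈-vertices x) px) (any? P? (vertices t))

glue : ∀ {a l r} {B : Set} → (Vertex l → B) → (Vertex r → B) → Vertex (node a l r) → B
glue f g (left x)  = f x
glue f g (right x) = g x

module _ {B : Set} (bs : List B) (∈-bs : ∀ b → b ∈ bs) where

  functions : (t : DTree) → List (Vertex t → B)
  functions leaf         = map const bs
  functions (node _ l r) = cartesianProductWith glue (functions l) (functions r)

  functions-complete : ∀ {t} (f : Vertex t → B) → ∃ λ g → g ∈ functions t × g ≗ f
  functions-complete {leaf} f = const (f here) , ∈-map⁺ const (∈-bs (f here)) , λ { here → refl }
  functions-complete {node _ _ _} f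
    with functions-complete (f ∘ left) | functions-complete (f ∘ right)
  ... | gl , gl∈ , gl≗ | gr , gr∈ , gr≗ =
    glue gl gr , ∈-cartesianProductWith⁺ glue gl∈ gr∈ , λ { (left x) → gl≗ x ; (right x) → gr≗ x }

  any-function? : ∀ {t} {P : (Vertex t → B) → Set} →
    (∀ {f g} → f ≗ g → P f → P g) → Decidable P → Dec (∃ P)
  any-function? {t} {P} resp P? = map′ satisfied witness (any? P? (functions t))
    where
    witness : ∃ P → Any P (functions t)
    witness (f , pf) with functions-complete f
    ... | g , g∈ , g≗f = lose g∈ (resp (sym ∘ g≗f) pf)

∈-booleans : ∀ b → b ∈ true ∷ false ∷ []
∈-booleans true  = here refl
∈-booleans false = there (here refl)

subsets : (t : DTree) → List (VSet t)
subsets = functions (true ∷ false ∷ []) ∈-booleans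

subsets-complete : ∀ {t} (S : VSet t) → ∃ λ S′ → S′ ∈ subsets t × S′ ≗ S
subsets-complete = functions-complete (true ∷ false ∷ []) ∈-booleans

any-subset? : ∀ {t} {P : VSet t → Set} → (∀ {S S′} → S ≗ S′ → P S → P S′) → Decidable P → Dec (∃ P)
any-subset? = any-function? (true ∷ false ∷ []) ∈-booleans

any-map? : ∀ {t} {P : (Vertex t → Vertex t) → Set} →
  (∀ {f g} → f ≗ g → P f → P g) → Decidable P → Dec (∃ P)
any-map? {t} = any-function? (vertices t) ∈-vertices

card-cong : ∀ t {S S′ : VSet t} → S ≗ S′ → card t S ≡ card t S′
card-cong leaf         S≗S′ = cong (λ b → if b then 1 else 0) (S≗S′ here)
card-cong (node _ l r) S≗S′ = cong₂ _+_ (card-cong l (S≗S′ ∘ left)) (card-cong r (S≗S′ ∘ right))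

PerfectMatchingOn : (t : DTree) → VSet t → (Vertex t → Vertex t) → Set
PerfectMatchingOn t W m = ∀ x → T (W x) → T (W (m x)) × (m x ≢ x) × Adj t x (m x) × (m (m x) ≡ x)

PerfectMatchingOn-cong : ∀ t W {m m′} → m ≗ m′ → PerfectMatchingOn t W m → PerfectMatchingOn t W m′
PerfectMatchingOn-cong t W {m} {m′} m≗m′ pm x Wx with pm x Wx
... | Wmx , mx≢x , adj-x-mx , mmx≡x =
  subst (T ∘ W) (m≗m′ x) Wmx ,
  (λ m′x≡x → mx≢x (trans (m≗m′ x) m′x≡x)) ,
  subst (Adj t x) (m≗m′ x) adj-x-mx ,
  (begin
    m′ (m′ x) ≡⟨ cong m′ (sym (m≗m′ x)) ⟩
    m′ (m x)  ≡⟨ sym (m≗m′ (m x)) ⟩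
    m (m x)   ≡⟨ mmx≡x ⟩
    x         ∎)
  where open ≡-Reasoning

HasPerfectMatching-cong : ∀ t {W W′} → W ≗ W′ → HasPerfectMatching t W → HasPerfectMatching t W′
HasPerfectMatching-cong t W≗W′ (m , pm) = m , λ x W′x →
  let Wmx , rest = pm x (subst T (sym (W≗W′ x)) W′x) in subst T (W≗W′ (m x)) Wmx , rest

HasPerfectMatching? : ∀ t W → Dec (HasPerfectMatching t W)
HasPerfectMatching? t W = any-map? (PerfectMatchingOn-cong t W) λ m → all-vertices? λ x →
  T? (W x) →-dec T? (W (m x)) ×-dec ¬? (m x ≟ x) ×-dec T? (adj t x (m x)) ×-dec m (m x) ≟ x

ExcessSet : (t : DTree) → ℕ → VSet t → VSet t → Set
ExcessSet t k S X =
  (∀ x → T (X x) → T (S x ∧ inTS t x)) × card t X ≡ k × HasPerfectMatching t (λ x → S x ∧ not (X x))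

ExcessSet-cong : ∀ t k S {X X′} → X ≗ X′ → ExcessSet t k S X → ExcessSet t k S X′
ExcessSet-cong t k S X≗X′ (X⊆S∩TS , |X|≡k , pm) =
  (λ x X′x → X⊆S∩TS x (subst T (sym (X≗X′ x)) X′x)) ,
  trans (sym (card-cong t X≗X′)) |X|≡k ,
  HasPerfectMatching-cong t (λ x → cong (λ b → S x ∧ not b) (X≗X′ x)) pm

Feasible? : ∀ t k → Decidable (Feasible t k)
Feasible? t k S = dominates? ×-dec any-subset? (ExcessSet-cong t k S) excess?
  where
  dominates? : Dec (DominatesOutsideTS t S)
  dominates? = all-vertices? λ x → T? (not (inTS t x)) →-dec
    any-vertex? λ y → T? (S y) ×-dec (y ≟ x ⊎-dec T? (adj t y x))
  excess? : Decidable (ExcessSet t k S)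
  excess? X = all-vertices? (λ x → T? (X x) →-dec T? (S x ∧ inTS t x))
    ×-dec card t X ≟ℕ k ×-dec HasPerfectMatching? t _

Feasible-cong : ∀ t k {S S′} → S ≗ S′ → Feasible t k S → Feasible t k S′
Feasible-cong t k S≗S′ (dom , X , X⊆S∩TS , |X|≡k , pm) =
  (λ x x∉TS → let y , Sy , y≈x = dom x x∉TS in y , subst T (S≗S′ y) Sy , y≈x) ,
  X ,
  (λ x Xx → subst (λ b → T (b ∧ inTS t x)) (S≗S′ x) (X⊆S∩TS x Xx)) ,
  |X|≡k ,
  HasPerfectMatching-cong t (λ x → cong (_∧ not (X x)) (S≗S′ x)) pm

γ̂-exists : ∀ t k S → Feasible t k S → ∃ λ g → IsGammaHat t k g × g ≤ card t S
γ̂-exists t k S feasS = card t S* , ((S* , feasS* , refl) , minimal) , minimal S feasS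
  where
  candidates : List (VSet t)
  candidates = filter (Feasible? t k) (subsets t)
  S* : VSet t
  S* = argmin (card t) S candidates
  feasS* : Feasible t k S*
  feasS* = argmin-all (card t) feasS (all-filter (Feasible? t k) (subsets t))
  minimal : ∀ S′ → Feasible t k S′ → card t S* ≤ card t S′
  minimal S′ feasS′ with subsets-complete S′
  ... | S″ , S″∈ , S″≗S′ = ≤-trans
    (All.lookup (f[argmin]≤f[xs] S candidates)
                (∈-filter⁺ (Feasible? t k) S″∈ (Feasible-cong t k (sym ∘ S″≗S′) feasS′)))
    (≤-reflexive (card-cong t S″≗S′))

record _⊑_ (t t′ : DTree) : Set where
  field
    to        : Vertex t → Vertex t′
    from      : Vertex t′ → Vertex t
    from-to   : ∀ x → from (to x) ≡ x
    to-from   : ∀ y → to (from y) ≡ y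
    to-adj    : ∀ {x y} → Adj t x y → Adj t′ (to x) (to y)
    to-inTS   : ∀ {x} → T (inTS t x) → T (inTS t′ (to x))
    card-from : ∀ S → card t′ (S ∘ from) ≡ card t S

T-not-contra : ∀ {a b} → (T a → T b) → T (not b) → T (not a)
T-not-contra {false}         _   _  = tt
T-not-contra {true}  {false} a⇒b _  = a⇒b tt
T-not-contra {true}  {true}  _   ()

module _ {t t′ : DTree} (t⊑t′ : t ⊑ t′) where
  open _⊑_ t⊑t′

  inTS-from⇒inTS : ∀ {y} → T (inTS t (from y)) → T (inTS t′ y)
  inTS-from⇒inTS {y} = subst (T ∘ inTS t′) (to-from y) ∘ to-inTS

  DominatesOutsideTS-⊑ : ∀ {S} → DominatesOutsideTS t S → DominatesOutsideTS t′ (S ∘ from)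
  DominatesOutsideTS-⊑ {S} dom y y∉TS with dom (from y) (T-not-contra inTS-from⇒inTS y∉TS)
  ... | x , Sx , inj₁ x≡from-y =
    to x , subst (T ∘ S) (sym (from-to x)) Sx , inj₁ (trans (cong to x≡from-y) (to-from y))
  ... | x , Sx , inj₂ adj-x-from-y =
    to x , subst (T ∘ S) (sym (from-to x)) Sx , inj₂ (subst (Adj t′ (to x)) (to-from y) (to-adj adj-x-from-y))

  HasPerfectMatching-⊑ : ∀ {W} → HasPerfectMatching t W → HasPerfectMatching t′ (W ∘ from)
  HasPerfectMatching-⊑ {W} (m , pm) = to ∘ m ∘ from , matched
    where
    matched : PerfectMatchingOn t′ (W ∘ from) (to ∘ m ∘ from)
    matched y Wy with pm (from y) Wy
    ... | Wm , m≢ , adj-m , mm≡ =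
      subst (T ∘ W) (sym (from-to _)) Wm ,
      (λ eq → m≢ (trans (sym (from-to _)) (cong from eq))) ,
      subst (λ z → Adj t′ z (to (m (from y)))) (to-from y) (to-adj adj-m) ,
      (begin
        to (m (from (to (m (from y))))) ≡⟨ cong (to ∘ m) (from-to _) ⟩
        to (m (m (from y)))             ≡⟨ cong to mm≡ ⟩
        to (from y)                     ≡⟨ to-from y ⟩
        y                               ∎)
      where open ≡-Reasoning

  Feasible-⊑ : ∀ {k S} → Feasible t k S → Feasible t′ k (S ∘ from)
  Feasible-⊑ {k} {S} (dom , X , X⊆S∩TS , |X|≡k , pm) =
    DominatesOutsideTS-⊑ dom ,
    X ∘ from ,
    (λ y Xy → let Sy , TSy = Equivalence.to T-∧ (X⊆S∩TS (from y) Xy) in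
      Equivalence.from T-∧ (Sy , inTS-from⇒inTS TSy)) ,
    trans (card-from X) |X|≡k ,
    HasPerfectMatching-⊑ pm

  γ̂-⊑ : ∀ {k g} → IsGammaHat t k g → ∃ λ g′ → IsGammaHat t′ k g′ × g′ ≤ g
  γ̂-⊑ {k} ((S , feasS , |S|≡g) , _) with γ̂-exists t′ k (S ∘ from) (Feasible-⊑ feasS)
  ... | g′ , γ̂ , g′≤ = g′ , γ̂ , subst (g′ ≤_) (trans (card-from S) |S|≡g) g′≤

relabel : ∀ {a b l r} → Vertex (node a l r) → Vertex (node b l r)
relabel (left x)  = left x
relabel (right x) = right x

relabel-involutive : ∀ {a b l r} (x : Vertex (node a l r)) → relabel {b = a} (relabel {b = b} x) ≡ x
relabel-involutive (left x)  = refl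
relabel-involutive (right x) = refl

⊕⊑⊗ : ∀ l r → node ⊕ l r ⊑ node ⊗ l r
⊕⊑⊗ l r = record
  { to        = relabel
  ; from      = relabel
  ; from-to   = relabel-involutive
  ; to-from   = relabel-involutive
  ; to-adj    = λ { {left _} {left _} a → a ; {left _} {right _} a → a
                  ; {right _} {left _} a → a ; {right _} {right _} a → a }
  ; to-inTS   = λ { {left _} ts → ts ; {right _} () }
  ; card-from = λ _ → refl
  }

lemma27 : (vl vr : DTree) (k : ℕ) → k ≤ tsSize (node ⊕ vl vr) →
    (g : ℕ) → IsGammaHat (node ⊕ vl vr) k g →
    Σ ℕ λ g' → IsGammaHat (node ⊗ vl vr) k g' × g' ≤ g
-- The bound on k is implied by the existence of γ̂_k(v).
lemma27 vl vr k _ g = γ̂-⊑ (⊕⊑⊗ vl vr)
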